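{- For every integer $k\ge5$ there exist vectors $\mathbf u=(u_0,\dots,u_{k-1}),\mathbf v=(v_0,\dots,v_{k-1})\in\mathbb{R}_{\ge0}^k$ satisfying: (i) $\sum_{i=0}^{k-1}(u_i+v_i)=1$; (ii) for every $\delta\in[-1/2,1/2]$, \begin{align*} &(1/2-\delta)\sum_{i=0}^{k-1}u_i+(1/2+\delta)\sum_{i=0}^{k-1}v_i +\sum_{i=0}^{k-1}u_i\left(-(1/2+\delta)^i(1/2-\delta)^{k-i}+(1/2-\delta)^i(1/2+\delta)^{k-i}\right)\\ &+\sum_{i=0}^{k-1}v_i\left(-(1/2+\delta)^{i+1}(1/2-\delta)^{k-1-i}+(1/2-\delta)^{i+1}(1/2+\delta)^{k-1-i}\right)=1/2; \end{align*} (iii) $p'\ge 1-\frac{k-2}{k-1}p_1$, where $p'=\frac{1}{k-1}\sum_{i=0}^{k-1}i(u_i+v_i)$ and $p_1=\sum_{i=0}^{k-1}u_i$.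
   Formalization: The vectors u and v are taken with nonnegative rational entries in place of real ones, and condition (ii) is required only for rational δ ∈ [−1/2, 1/2]. -}

module Defs where

open import Data.Nat using (ℕ; zero; suc)
open import Data.Fin using (Fin; zero; suc)
open import Data.Integer using (+_)
open import Data.Rational using (ℚ; 0ℚ; 1ℚ; _+_; _*_; _/_)

_^ℚ_ : ℚ → ℕ → ℚ
x ^ℚ zero = 1ℚ
x ^ℚ suc n = x * (x ^ℚ n)

sumFin : ∀ {k} → (Fin k → ℚ) → ℚ
sumFin {zero} f = 0ℚ
sumFin {suc k} f = f zero + sumFin (λ i → f (suc i))

ℕtoℚ : ℕ → ℚ
ℕtoℚ n = + n / 1

-- 1/n for n ≥ 1 (convention 1/0 = 0, never used: only applied to k-1 ≥ 4)
invℕ : ℕ → ℚ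
invℕ zero = 0ℚ
invℕ (suc n) = + 1 / suc n

{-# OPTIONS --safe #-}
module Submission where

open import Defs
open import Data.Nat using (ℕ; suc; _∸_) renaming (_≤_ to _≤ℕ_)
open import Data.Fin using (Fin; toℕ)
open import Data.Product using (Σ; _×_)
open import Relation.Binary.PropositionalEquality using (_≡_)
open import Data.Rational using (ℚ; 0ℚ; 1ℚ; ½; _+_; _*_; _-_; -_; _≤_)

open import Data.Nat as ℕ using (zero; s≤s)
import Data.Nat.Properties as ℕ
open import Data.Nat.Coprimality using (Coprime; 1-coprimeTo) renaming (sym to coprime-sym)
open import Data.Product using (_,_)
import Data.Integer as ℤ
import Data.Integer.Properties as ℤ
open import Data.Rational using (_/_; mkℚ; nonNegative)
open import Data.Rational.Properties
  using ( +-*-ring; +-*-commutativeRing; _≟_; +-comm; +-identityʳ; +-inverseʳ; *-identityʳ; *-inverseʳ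
        ; normalize-coprime; normalize-nonNeg; /-cong; ≤ᵇ⇒≤; ≤-trans; +-mono-≤; +-monoˡ-≤; +-monoʳ-≤
        ; *-monoˡ-≤-nonNeg; nonNegative⁻¹; nonNeg*nonNeg⇒nonNeg; module ≤-Reasoning )
open import Relation.Nullary.Decidable using (dec⇒maybe)
open import Relation.Binary.PropositionalEquality using (refl; sym; trans; cong; cong₂; subst; module ≡-Reasoning)
open import Level using (0ℓ)
open import Algebra.Bundles using (Ring)
open import Algebra.Properties.Semiring.Sum (Ring.semiring +-*-ring) using (sum; ∑-distrib-+; *-distribˡ-sum)
open import Tactic.RingSolver using (solve-∀)
open import Tactic.RingSolver.Core.AlmostCommutativeRing using (AlmostCommutativeRing; fromCommutativeRing)
open import Data.Rational.Solver using (module +-*-Solver)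
open +-*-Solver using (solve; _:=_; con; _:+_; _:*_; _:-_; :-_; _:^_)

-- Put n = k - 4 and h = 2⁻ⁿ, and take u and v to be mixtures of the shifted binomial laws
-- s + Bin(n, ½): u of the shift 3 alone, v of the shifts 2 and 3.  Against such a law the kernels
-- of (ii) sum in closed form by the homogeneous binomial theorem
--   Σⱼ 2⁻ⁿ C(n, j - s) xʲ y^(K - j) = xˢ yᵗ ((x + y)/2)ⁿ      (K = s + n + t),
-- so, as (½ - δ) + (½ + δ) = 1, the left side of (ii) becomes c₀ + c₁δ + c₃δ³ with coefficients
-- linear in the three mixture weights; these are chosen to make it ½.  The means s + n/2 of the
-- laws reduce (iii) to (n + 3)·2⁻ⁿ ≤ 5/2, which holds exactly when n ≥ 1.

ℚ-ring : AlmostCommutativeRing 0ℓ 0ℓ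
ℚ-ring = fromCommutativeRing +-*-commutativeRing (λ x → dec⇒maybe (0ℚ ≟ x))

infixr 8 _^_
_^_ : ℚ → ℕ → ℚ
_^_ = _^ℚ_

0≤+ : ∀ {p q} → 0ℚ ≤ p → 0ℚ ≤ q → 0ℚ ≤ p + q
0≤+ = +-mono-≤

0≤* : ∀ {p q} → 0ℚ ≤ p → 0ℚ ≤ q → 0ℚ ≤ p * q
0≤* {p} {q} 0≤p 0≤q =
  nonNegative⁻¹ (p * q) {{nonNeg*nonNeg⇒nonNeg p {{nonNegative 0≤p}} q {{nonNegative 0≤q}}}}

p≤q⇒0≤q-p : ∀ {p q} → p ≤ q → 0ℚ ≤ q - p
p≤q⇒0≤q-p {p} {q} p≤q = subst (_≤ q - p) (+-inverseʳ p) (+-monoˡ-≤ (- p) p≤q)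

0≤½ : 0ℚ ≤ ½
0≤½ = ≤ᵇ⇒≤ _

½^n-nonNeg : ∀ n → 0ℚ ≤ ½ ^ n
½^n-nonNeg zero    = ≤ᵇ⇒≤ _
½^n-nonNeg (suc n) = 0≤* 0≤½ (½^n-nonNeg n)

½^n≤1 : ∀ n → ½ ^ n ≤ 1ℚ
½^n≤1 zero    = ≤ᵇ⇒≤ _
½^n≤1 (suc n) = ≤-trans (*-monoˡ-≤-nonNeg ½ (½^n≤1 n)) (≤ᵇ⇒≤ _)

ℕtoℚ-+ : ∀ m n → ℕtoℚ (m ℕ.+ n) ≡ ℕtoℚ m + ℕtoℚ n
ℕtoℚ-+ m n = sym (begin
  ℕtoℚ m + ℕtoℚ n
    ≡⟨ cong₂ _+_ (normalize-coprime (/1 m)) (normalize-coprime (/1 n)) ⟩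
  mkℚ (ℤ.+ m) 0 (/1 m) + mkℚ (ℤ.+ n) 0 (/1 n)
    ≡⟨ /-cong (cong₂ ℤ._+_ (ℤ.*-identityʳ (ℤ.+ m)) (ℤ.*-identityʳ (ℤ.+ n))) refl ⟩
  ℕtoℚ (m ℕ.+ n) ∎)
  where
  open ≡-Reasoning
  /1 : ∀ m → Coprime m 1
  /1 m = coprime-sym (1-coprimeTo m)

ℕtoℚ*invℕ≡1 : ∀ m → ℕtoℚ (suc m) * invℕ (suc m) ≡ 1ℚ
ℕtoℚ*invℕ≡1 m = trans (cong₂ _*_ (normalize-coprime [1+m]/1) (normalize-coprime 1/[1+m]))
                      (*-inverseʳ (mkℚ (ℤ.+ suc m) 0 [1+m]/1))
  where
  [1+m]/1 : Coprime (suc m) 1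
  [1+m]/1 = coprime-sym (1-coprimeTo (suc m))
  1/[1+m] : Coprime 1 (suc m)
  1/[1+m] = 1-coprimeTo (suc m)

invℕ-nonNeg : ∀ m → 0ℚ ≤ invℕ (suc m)
invℕ-nonNeg m = nonNegative⁻¹ (invℕ (suc m)) {{normalize-nonNeg 1 (suc m)}}

∑ : ℕ → (ℕ → ℚ) → ℚ
∑ L F = sumFin {L} (λ i → F (toℕ i))

sumFin≡sum : ∀ {L} (f : Fin L → ℚ) → sumFin f ≡ sum f
sumFin≡sum {zero}  f = refl
sumFin≡sum {suc L} f = cong (f Fin.zero +_) (sumFin≡sum (λ i → f (Fin.suc i)))

∑-cong : ∀ L {F G : ℕ → ℚ} → (∀ j → F j ≡ G j) → ∑ L F ≡ ∑ L G
∑-cong zero    F≗G = refl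
∑-cong (suc L) F≗G = cong₂ _+_ (F≗G 0) (∑-cong L (λ j → F≗G (suc j)))

∑-+ : ∀ L (F G : ℕ → ℚ) → ∑ L (λ j → F j + G j) ≡ ∑ L F + ∑ L G
∑-+ L F G = begin
  ∑ L (λ j → F j + G j)    ≡⟨ sumFin≡sum (λ i → F′ i + G′ i) ⟩
  sum (λ i → F′ i + G′ i)  ≡⟨ ∑-distrib-+ F′ G′ ⟩
  sum F′ + sum G′          ≡⟨ sym (cong₂ _+_ (sumFin≡sum F′) (sumFin≡sum G′)) ⟩
  ∑ L F + ∑ L G            ∎
  where
  open ≡-Reasoning
  F′ G′ : Fin L → ℚ
  F′ i = F (toℕ i)
  G′ i = G (toℕ i)

∑-scale : ∀ L α (F : ℕ → ℚ) → ∑ L (λ j → α * F j) ≡ α * ∑ L F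
∑-scale L α F = begin
  ∑ L (λ j → α * F j)   ≡⟨ sumFin≡sum (λ i → α * F′ i) ⟩
  sum (λ i → α * F′ i)  ≡⟨ sym (*-distribˡ-sum α F′) ⟩
  α * sum F′            ≡⟨ sym (cong (α *_) (sumFin≡sum F′)) ⟩
  α * ∑ L F             ∎
  where
  open ≡-Reasoning
  F′ : Fin L → ℚ
  F′ i = F (toℕ i)

∑-linear : ∀ L α β (F G : ℕ → ℚ) → ∑ L (λ j → α * F j + β * G j) ≡ α * ∑ L F + β * ∑ L G
∑-linear L α β F G =
  trans (∑-+ L (λ j → α * F j) (λ j → β * G j)) (cong₂ _+_ (∑-scale L α F) (∑-scale L β G))

kronecker : ℕ → ℕ → ℚ
kronecker zero    zero    = 1ℚ
kronecker zero    (suc j) = 0ℚ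
kronecker (suc s) zero    = 0ℚ
kronecker (suc s) (suc j) = kronecker s j

kronecker-nonNeg : ∀ s j → 0ℚ ≤ kronecker s j
kronecker-nonNeg zero    zero    = ≤ᵇ⇒≤ _
kronecker-nonNeg zero    (suc j) = ≤ᵇ⇒≤ _
kronecker-nonNeg (suc s) zero    = ≤ᵇ⇒≤ _
kronecker-nonNeg (suc s) (suc j) = kronecker-nonNeg s j

∑-kronecker : ∀ {L s} (F : ℕ → ℚ) → s ℕ.< L → ∑ L (λ j → kronecker s j * F j) ≡ F s
∑-kronecker {suc L} {zero} F _ = begin
  1ℚ * F 0 + ∑ L (λ j → 0ℚ * F (suc j))
    ≡⟨ cong (1ℚ * F 0 +_) (∑-scale L 0ℚ (λ j → F (suc j))) ⟩
  1ℚ * F 0 + 0ℚ * ∑ L (λ j → F (suc j))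
    ≡⟨ drop-zero (F 0) (∑ L (λ j → F (suc j))) ⟩
  F 0 ∎
  where
  open ≡-Reasoning
  drop-zero : ∀ x y → 1ℚ * x + 0ℚ * y ≡ x
  drop-zero = solve-∀ ℚ-ring
∑-kronecker {suc L} {suc s} F (s≤s s<L) = begin
  0ℚ * F 0 + ∑ L (λ j → kronecker s j * F (suc j))
    ≡⟨ cong (0ℚ * F 0 +_) (∑-kronecker (λ j → F (suc j)) s<L) ⟩
  0ℚ * F 0 + F (suc s)
    ≡⟨ drop-zero (F 0) (F (suc s)) ⟩
  F (suc s) ∎
  where
  open ≡-Reasoning
  drop-zero : ∀ x y → 0ℚ * x + y ≡ y
  drop-zero = solve-∀ ℚ-ring

-- shiftedBinomial n s j = 2⁻ⁿ·C(n, j - s) is the law of s + Bin(n, ½), supported on s ≤ j ≤ s + n;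
-- 𝔼 L n s F is its expectation of F, summed over j < L and hence exact when s + n < L.
shiftedBinomial : ℕ → ℕ → ℕ → ℚ
shiftedBinomial zero    s j = kronecker s j
shiftedBinomial (suc n) s j = ½ * shiftedBinomial n s j + ½ * shiftedBinomial n (suc s) j

𝔼 : ℕ → ℕ → ℕ → (ℕ → ℚ) → ℚ
𝔼 L n s F = ∑ L (λ j → shiftedBinomial n s j * F j)

shiftedBinomial-nonNeg : ∀ n s j → 0ℚ ≤ shiftedBinomial n s j
shiftedBinomial-nonNeg zero    s j = kronecker-nonNeg s j
shiftedBinomial-nonNeg (suc n) s j =
  0≤+ (0≤* 0≤½ (shiftedBinomial-nonNeg n s j)) (0≤* 0≤½ (shiftedBinomial-nonNeg n (suc s) j))

s+0<L⇒s<L : ∀ {s L} → s ℕ.+ 0 ℕ.< L → s ℕ.< L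
s+0<L⇒s<L {s} {L} = subst (ℕ._< L) (ℕ.+-identityʳ s)

s+[1+n]<L⇒[1+s]+n<L : ∀ {s n L} → s ℕ.+ suc n ℕ.< L → suc s ℕ.+ n ℕ.< L
s+[1+n]<L⇒[1+s]+n<L {s} {n} {L} = subst (ℕ._< L) (ℕ.+-suc s n)

∑-shiftedBinomial : ∀ {L} n s → s ℕ.+ n ℕ.< L → ∑ L (shiftedBinomial n s) ≡ 1ℚ
∑-shiftedBinomial {L} zero s s+0<L =
  trans (∑-cong L (λ j → sym (*-identityʳ (kronecker s j)))) (∑-kronecker (λ _ → 1ℚ) (s+0<L⇒s<L s+0<L))
∑-shiftedBinomial {L} (suc n) s s+n<L = begin
  ∑ L (shiftedBinomial (suc n) s)
    ≡⟨ ∑-linear L ½ ½ (shiftedBinomial n s) (shiftedBinomial n (suc s)) ⟩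
  ½ * ∑ L (shiftedBinomial n s) + ½ * ∑ L (shiftedBinomial n (suc s))
    ≡⟨ cong₂ (λ x y → ½ * x + ½ * y) (∑-shiftedBinomial n s (ℕ.<⇒≤ ss+n<L))
                                     (∑-shiftedBinomial n (suc s) ss+n<L) ⟩
  ½ * 1ℚ + ½ * 1ℚ
    ≡⟨⟩
  1ℚ ∎
  where
  open ≡-Reasoning
  ss+n<L = s+[1+n]<L⇒[1+s]+n<L s+n<L

𝔼-zero : ∀ {L s} (F : ℕ → ℚ) → s ℕ.+ 0 ℕ.< L → 𝔼 L 0 s F ≡ F s
𝔼-zero F s+0<L = ∑-kronecker F (s+0<L⇒s<L s+0<L)

𝔼-suc : ∀ L n s (F : ℕ → ℚ) → 𝔼 L (suc n) s F ≡ ½ * 𝔼 L n s F + ½ * 𝔼 L n (suc s) F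
𝔼-suc L n s F = trans
  (∑-cong L (λ j → distrib (shiftedBinomial n s j) (shiftedBinomial n (suc s) j) (F j)))
  (∑-linear L ½ ½ (λ j → shiftedBinomial n s j * F j) (λ j → shiftedBinomial n (suc s) j * F j))
  where
  distrib : ∀ x y z → (½ * x + ½ * y) * z ≡ ½ * (x * z) + ½ * (y * z)
  distrib = solve-∀ ℚ-ring

𝔼-ℕtoℚ : ∀ {L} n s → s ℕ.+ n ℕ.< L → 𝔼 L n s ℕtoℚ ≡ ℕtoℚ s + ½ * ℕtoℚ n
𝔼-ℕtoℚ zero s s+0<L = trans (𝔼-zero ℕtoℚ s+0<L) (sym (+-identityʳ (ℕtoℚ s)))
𝔼-ℕtoℚ {L} (suc n) s s+n<L = begin
  𝔼 L (suc n) s ℕtoℚ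
    ≡⟨ 𝔼-suc L n s ℕtoℚ ⟩
  ½ * 𝔼 L n s ℕtoℚ + ½ * 𝔼 L n (suc s) ℕtoℚ
    ≡⟨ cong₂ (λ x y → ½ * x + ½ * y) (𝔼-ℕtoℚ n s (ℕ.<⇒≤ ss+n<L)) (𝔼-ℕtoℚ n (suc s) ss+n<L) ⟩
  ½ * (S + ½ * N) + ½ * (ℕtoℚ (suc s) + ½ * N)
    ≡⟨ cong (λ x → ½ * (S + ½ * N) + ½ * (x + ½ * N)) (ℕtoℚ-+ 1 s) ⟩
  ½ * (S + ½ * N) + ½ * ((1ℚ + S) + ½ * N)
    ≡⟨ average S N ⟩
  S + ½ * (1ℚ + N)
    ≡⟨ cong (λ x → S + ½ * x) (sym (ℕtoℚ-+ 1 n)) ⟩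
  S + ½ * ℕtoℚ (suc n) ∎
  where
  open ≡-Reasoning
  ss+n<L = s+[1+n]<L⇒[1+s]+n<L s+n<L
  S N : ℚ
  S = ℕtoℚ s
  N = ℕtoℚ n
  average : ∀ S N → ½ * (S + ½ * N) + ½ * ((1ℚ + S) + ½ * N) ≡ S + ½ * (1ℚ + N)
  average = solve-∀ ℚ-ring

monomial : ℕ → ℚ → ℚ → ℕ → ℚ
monomial K x y j = x ^ j * y ^ (K ∸ j)

𝔼-monomial : ∀ {L K} n s t x y → s ℕ.+ n ℕ.+ t ≡ K → s ℕ.+ n ℕ.< L →
             𝔼 L n s (monomial K x y) ≡ x ^ s * y ^ t * (½ * (x + y)) ^ n
𝔼-monomial {L} {K} zero s t x y s+0+t≡K s+0<L = begin
  𝔼 L 0 s (monomial K x y)  ≡⟨ 𝔼-zero (monomial K x y) s+0<L ⟩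
  x ^ s * y ^ (K ∸ s)       ≡⟨ cong (λ e → x ^ s * y ^ e) K∸s≡t ⟩
  x ^ s * y ^ t             ≡⟨ sym (*-identityʳ (x ^ s * y ^ t)) ⟩
  x ^ s * y ^ t * 1ℚ        ∎
  where
  open ≡-Reasoning
  K∸s≡t : K ∸ s ≡ t
  K∸s≡t = begin
    K ∸ s              ≡⟨ cong (_∸ s) (sym s+0+t≡K) ⟩
    s ℕ.+ 0 ℕ.+ t ∸ s  ≡⟨ cong (λ m → m ℕ.+ t ∸ s) (ℕ.+-identityʳ s) ⟩
    s ℕ.+ t ∸ s        ≡⟨ ℕ.m+n∸m≡n s t ⟩
    t                  ∎
𝔼-monomial {L} {K} (suc n) s t x y s+n+t≡K s+n<L = begin
  𝔼 L (suc n) s (monomial K x y)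
    ≡⟨ 𝔼-suc L n s (monomial K x y) ⟩
  ½ * 𝔼 L n s (monomial K x y) + ½ * 𝔼 L n (suc s) (monomial K x y)
    ≡⟨ cong₂ (λ p q → ½ * p + ½ * q) (𝔼-monomial n s (suc t) x y s+n+[1+t]≡K (ℕ.<⇒≤ ss+n<L))
                                     (𝔼-monomial n (suc s) t x y [1+s]+n+t≡K ss+n<L) ⟩
  ½ * (X * (y * Y) * C) + ½ * ((x * X) * Y * C)
    ≡⟨ average x y X Y C ⟩
  X * Y * ((½ * (x + y)) * C) ∎
  where
  open ≡-Reasoning
  ss+n<L = s+[1+n]<L⇒[1+s]+n<L s+n<L
  X Y C : ℚ
  X = x ^ s
  Y = y ^ t
  C = (½ * (x + y)) ^ n
  [1+s]+n+t≡K : suc s ℕ.+ n ℕ.+ t ≡ K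
  [1+s]+n+t≡K = trans (cong (ℕ._+ t) (sym (ℕ.+-suc s n))) s+n+t≡K
  s+n+[1+t]≡K : s ℕ.+ n ℕ.+ suc t ≡ K
  s+n+[1+t]≡K = trans (ℕ.+-suc (s ℕ.+ n) t) [1+s]+n+t≡K
  average : ∀ x y X Y C → ½ * (X * (y * Y) * C) + ½ * ((x * X) * Y * C) ≡ X * Y * ((½ * (x + y)) * C)
  average = solve-∀ ℚ-ring

𝔼-skew : ∀ {L K} n s t {x y} α β → x + y ≡ 1ℚ → s ℕ.+ n ℕ.+ t ≡ K → s ℕ.+ n ℕ.< L →
         𝔼 L n s (λ j → - (α * monomial K y x j) + β * monomial K x y j)
           ≡ (- (α * (y ^ s * x ^ t)) + β * (x ^ s * y ^ t)) * ½ ^ n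
𝔼-skew {L} {K} n s t {x} {y} α β x+y≡1 s+n+t≡K s+n<L = begin
  𝔼 L n s (λ j → - (α * monomial K y x j) + β * monomial K x y j)
    ≡⟨ ∑-cong L (λ j → distrib α β (B j) (monomial K y x j) (monomial K x y j)) ⟩
  ∑ L (λ j → (- α) * (B j * monomial K y x j) + β * (B j * monomial K x y j))
    ≡⟨ ∑-linear L (- α) β (λ j → B j * monomial K y x j) (λ j → B j * monomial K x y j) ⟩
  (- α) * 𝔼 L n s (monomial K y x) + β * 𝔼 L n s (monomial K x y)
    ≡⟨ cong₂ (λ p q → (- α) * p + β * q) (𝔼-monomial n s t y x s+n+t≡K s+n<L)
                                         (𝔼-monomial n s t x y s+n+t≡K s+n<L) ⟩
  (- α) * (y ^ s * x ^ t * (½ * (y + x)) ^ n) + β * (x ^ s * y ^ t * (½ * (x + y)) ^ n)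
    ≡⟨ cong₂ (λ p q → (- α) * (y ^ s * x ^ t * (½ * p) ^ n) + β * (x ^ s * y ^ t * (½ * q) ^ n))
             (trans (+-comm y x) x+y≡1) x+y≡1 ⟩
  (- α) * (y ^ s * x ^ t * ½ ^ n) + β * (x ^ s * y ^ t * ½ ^ n)
    ≡⟨ regroup α β (y ^ s * x ^ t) (x ^ s * y ^ t) (½ ^ n) ⟩
  (- (α * (y ^ s * x ^ t)) + β * (x ^ s * y ^ t)) * ½ ^ n ∎
  where
  open ≡-Reasoning
  B : ℕ → ℚ
  B = shiftedBinomial n s
  distrib : ∀ α β b X Y → b * (- (α * X) + β * Y) ≡ (- α) * (b * X) + β * (b * Y)
  distrib = solve-∀ ℚ-ring
  regroup : ∀ α β A B h → (- α) * (A * h) + β * (B * h) ≡ (- (α * A) + β * B) * h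
  regroup = solve-∀ ℚ-ring

[3+n]½^n≤5/2 : ∀ m → ℕtoℚ (3 ℕ.+ suc m) * ½ ^ suc m ≤ ℤ.+ 5 / 2
[3+n]½^n≤5/2 zero    = ≤ᵇ⇒≤ _
[3+n]½^n≤5/2 (suc m) = begin
  ℕtoℚ (4 ℕ.+ n) * (½ * h)          ≡⟨ cong (_* (½ * h)) (ℕtoℚ-+ 1 (3 ℕ.+ n)) ⟩
  (1ℚ + ℕtoℚ (3 ℕ.+ n)) * (½ * h)   ≡⟨ halve (ℕtoℚ (3 ℕ.+ n)) h ⟩
  ½ * (ℕtoℚ (3 ℕ.+ n) * h) + ½ * h  ≤⟨ +-mono-≤ (*-monoˡ-≤-nonNeg ½ ([3+n]½^n≤5/2 m))
                                               (*-monoˡ-≤-nonNeg ½ (½^n≤1 n)) ⟩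
  ½ * (ℤ.+ 5 / 2) + ½ * 1ℚ          ≤⟨ ≤ᵇ⇒≤ _ ⟩
  ℤ.+ 5 / 2                         ∎
  where
  open ≤-Reasoning
  n = suc m
  h = ½ ^ n
  halve : ∀ N h → (1ℚ + N) * (½ * h) ≡ ½ * (N * h) + ½ * h
  halve = solve-∀ ℚ-ring

⅓ ⅙ : ℚ
⅓ = ℤ.+ 1 / 3
⅙ = ℤ.+ 1 / 6

0≤⅓ : 0ℚ ≤ ⅓
0≤⅓ = ≤ᵇ⇒≤ _

0≤⅙ : 0ℚ ≤ ⅙
0≤⅙ = ≤ᵇ⇒≤ _

module Witness (n : ℕ) where

  k : ℕ
  k = 4 ℕ.+ n

  -- P, Q and R are forced by (i) and by the vanishing of the δ and δ³ coefficients in (ii).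
  h P Q R : ℚ
  h = ½ ^ n
  P = ½ - ⅓ * h
  Q = ⅙ + ⅓ * h
  R = ⅓

  u v : ℕ → ℚ
  u j = P * shiftedBinomial n 3 j
  v j = Q * shiftedBinomial n 2 j + R * shiftedBinomial n 3 j

  3+n<k : 3 ℕ.+ n ℕ.< k
  3+n<k = ℕ.n<1+n _

  2+n<k : 2 ℕ.+ n ℕ.< k
  2+n<k = ℕ.m<n⇒m<1+n (ℕ.n<1+n _)

  0≤P : 0ℚ ≤ P
  0≤P = p≤q⇒0≤q-p (≤-trans (*-monoˡ-≤-nonNeg ⅓ (½^n≤1 n)) ⅓*1≤½)
    where
    ⅓*1≤½ : ⅓ * 1ℚ ≤ ½
    ⅓*1≤½ = ≤ᵇ⇒≤ _

  0≤Q : 0ℚ ≤ Q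
  0≤Q = 0≤+ 0≤⅙ (0≤* 0≤⅓ (½^n-nonNeg n))

  u-nonNeg : ∀ j → 0ℚ ≤ u j
  u-nonNeg j = 0≤* 0≤P (shiftedBinomial-nonNeg n 3 j)

  v-nonNeg : ∀ j → 0ℚ ≤ v j
  v-nonNeg j = 0≤+ (0≤* 0≤Q (shiftedBinomial-nonNeg n 2 j)) (0≤* 0≤⅓ (shiftedBinomial-nonNeg n 3 j))

  ∑u≡P : ∑ k u ≡ P
  ∑u≡P = begin
    ∑ k u                          ≡⟨ ∑-scale k P (shiftedBinomial n 3) ⟩
    P * ∑ k (shiftedBinomial n 3)  ≡⟨ cong (P *_) (∑-shiftedBinomial n 3 3+n<k) ⟩
    P * 1ℚ                         ≡⟨ *-identityʳ P ⟩
    P                              ∎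
    where open ≡-Reasoning

  ∑v≡Q+R : ∑ k v ≡ Q + R
  ∑v≡Q+R = begin
    ∑ k v
      ≡⟨ ∑-linear k Q R (shiftedBinomial n 2) (shiftedBinomial n 3) ⟩
    Q * ∑ k (shiftedBinomial n 2) + R * ∑ k (shiftedBinomial n 3)
      ≡⟨ cong₂ (λ x y → Q * x + R * y) (∑-shiftedBinomial n 2 2+n<k) (∑-shiftedBinomial n 3 3+n<k) ⟩
    Q * 1ℚ + R * 1ℚ
      ≡⟨ cong₂ _+_ (*-identityʳ Q) (*-identityʳ R) ⟩
    Q + R ∎
    where open ≡-Reasoning

  ∑[u+v]≡1 : ∑ k (λ j → u j + v j) ≡ 1ℚ
  ∑[u+v]≡1 = trans (∑-+ k u v) (trans (cong₂ _+_ ∑u≡P ∑v≡Q+R) (total h))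
    where
    total : ∀ h → (½ - ⅓ * h) + ((⅙ + ⅓ * h) + ⅓) ≡ 1ℚ
    total = solve-∀ ℚ-ring

  first-moment : ∑ k (λ j → ℕtoℚ j * (u j + v j))
                 ≡ Q * (ℕtoℚ 2 + ½ * ℕtoℚ n) + (P + R) * (ℕtoℚ 3 + ½ * ℕtoℚ n)
  first-moment = begin
    ∑ k (λ j → ℕtoℚ j * (u j + v j))
      ≡⟨ ∑-cong k (λ j → regroup P Q R (B₂ j) (B₃ j) (ℕtoℚ j)) ⟩
    ∑ k (λ j → Q * (B₂ j * ℕtoℚ j) + (P + R) * (B₃ j * ℕtoℚ j))
      ≡⟨ ∑-linear k Q (P + R) (λ j → B₂ j * ℕtoℚ j) (λ j → B₃ j * ℕtoℚ j) ⟩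
    Q * 𝔼 k n 2 ℕtoℚ + (P + R) * 𝔼 k n 3 ℕtoℚ
      ≡⟨ cong₂ (λ x y → Q * x + (P + R) * y) (𝔼-ℕtoℚ n 2 2+n<k) (𝔼-ℕtoℚ n 3 3+n<k) ⟩
    Q * (ℕtoℚ 2 + ½ * ℕtoℚ n) + (P + R) * (ℕtoℚ 3 + ½ * ℕtoℚ n) ∎
    where
    open ≡-Reasoning
    B₂ B₃ : ℕ → ℚ
    B₂ = shiftedBinomial n 2
    B₃ = shiftedBinomial n 3
    regroup : ∀ P Q R B C J → J * (P * C + (Q * B + R * C)) ≡ Q * (B * J) + (P + R) * (C * J)
    regroup = solve-∀ ℚ-ring

  moment-inequality : ℕtoℚ (3 ℕ.+ n) * h ≤ ℤ.+ 5 / 2 →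
                      1ℚ - (ℕtoℚ (2 ℕ.+ n) * invℕ (3 ℕ.+ n)) * ∑ k u
                        ≤ invℕ (3 ℕ.+ n) * ∑ k (λ j → ℕtoℚ j * (u j + v j))
  moment-inequality [3+n]h≤5/2 = begin
    1ℚ - (N₂ * I) * ∑ k u
      ≡⟨ cong (λ x → 1ℚ - (N₂ * I) * x) ∑u≡P ⟩
    X
      ≡⟨ sym (+-identityʳ X) ⟩
    X + 0ℚ
      ≤⟨ +-monoʳ-≤ X (0≤* (invℕ-nonNeg (2 ℕ.+ n)) (0≤* 0≤⅓ (p≤q⇒0≤q-p [3+n]h≤5/2))) ⟩
    X + I * (⅓ * (ℤ.+ 5 / 2 - N₃ * h))
      ≡⟨ cong (λ x → (x - (N₂ * I) * P) + I * (⅓ * (ℤ.+ 5 / 2 - N₃ * h)))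
              (sym (ℕtoℚ*invℕ≡1 (2 ℕ.+ n))) ⟩
    (N₃ * I - (N₂ * I) * P) + I * (⅓ * (ℤ.+ 5 / 2 - N₃ * h))
      ≡⟨ cong₂ (λ N₃ N₂ → (N₃ * I - (N₂ * I) * P) + I * (⅓ * (ℤ.+ 5 / 2 - N₃ * h)))
               (ℕtoℚ-+ 3 n) (ℕtoℚ-+ 2 n) ⟩
    ((ℕtoℚ 3 + N) * I - ((ℕtoℚ 2 + N) * I) * P) + I * (⅓ * (ℤ.+ 5 / 2 - (ℕtoℚ 3 + N) * h))
      ≡⟨ slack N I h ⟩
    I * (Q * (ℕtoℚ 2 + ½ * N) + (P + R) * (ℕtoℚ 3 + ½ * N))
      ≡⟨ cong (I *_) (sym first-moment) ⟩
    I * ∑ k (λ j → ℕtoℚ j * (u j + v j)) ∎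
    where
    open ≤-Reasoning
    I N N₂ N₃ X : ℚ
    I = invℕ (3 ℕ.+ n)
    N = ℕtoℚ n
    N₂ = ℕtoℚ (2 ℕ.+ n)
    N₃ = ℕtoℚ (3 ℕ.+ n)
    X = 1ℚ - (N₂ * I) * P
    slack : ∀ N I h →
      ((ℕtoℚ 3 + N) * I - ((ℕtoℚ 2 + N) * I) * (½ - ⅓ * h))
        + I * (⅓ * (ℤ.+ 5 / 2 - (ℕtoℚ 3 + N) * h))
        ≡ I * ((⅙ + ⅓ * h) * (ℕtoℚ 2 + ½ * N) + ((½ - ⅓ * h) + ⅓) * (ℕtoℚ 3 + ½ * N))
    slack = solve-∀ ℚ-ring

  module _ (δ : ℚ) where

    a b : ℚ
    a = ½ - δ
    b = ½ + δ

    a+b≡1 : a + b ≡ 1ℚ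
    a+b≡1 = halves δ
      where
      halves : ∀ δ → (½ - δ) + (½ + δ) ≡ 1ℚ
      halves = solve-∀ ℚ-ring

    ∑u-skew : ∑ k (λ j → u j * (- monomial k b a j + monomial k a b j))
              ≡ P * ((- (1ℚ * (b ^ 3 * a ^ 1)) + 1ℚ * (a ^ 3 * b ^ 1)) * h)
    ∑u-skew = begin
      ∑ k (λ j → u j * (- monomial k b a j + monomial k a b j))
        ≡⟨ ∑-cong k (λ j → unit-weights P (B₃ j) (monomial k b a j) (monomial k a b j)) ⟩
      ∑ k (λ j → P * (B₃ j * κ j))
        ≡⟨ ∑-scale k P (λ j → B₃ j * κ j) ⟩
      P * 𝔼 k n 3 κ
        ≡⟨ cong (P *_) (𝔼-skew {K = k} n 3 1 {a} {b} 1ℚ 1ℚ a+b≡1 (cong (3 ℕ.+_) (ℕ.+-comm n 1))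
                                3+n<k) ⟩
      P * ((- (1ℚ * (b ^ 3 * a ^ 1)) + 1ℚ * (a ^ 3 * b ^ 1)) * h) ∎
      where
      open ≡-Reasoning
      B₃ κ : ℕ → ℚ
      B₃ = shiftedBinomial n 3
      κ j = - (1ℚ * monomial k b a j) + 1ℚ * monomial k a b j
      unit-weights : ∀ P B X Y → (P * B) * (- X + Y) ≡ P * (B * (- (1ℚ * X) + 1ℚ * Y))
      unit-weights = solve-∀ ℚ-ring

    ∑v-skew : ∑ k (λ j → v j * (- (b ^ suc j * a ^ (k ∸ 1 ∸ j)) + a ^ suc j * b ^ (k ∸ 1 ∸ j)))
              ≡ Q * ((- (b * (b ^ 2 * a ^ 1)) + a * (a ^ 2 * b ^ 1)) * h)
                + R * ((- (b * (b ^ 3 * a ^ 0)) + a * (a ^ 3 * b ^ 0)) * h)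
    ∑v-skew = begin
      ∑ k (λ j → v j * (- (b ^ suc j * a ^ (K ∸ j)) + a ^ suc j * b ^ (K ∸ j)))
        ≡⟨ ∑-cong k (λ j → split-weights Q R (B₂ j) (B₃ j) b a
                                         (b ^ j) (a ^ (K ∸ j)) (a ^ j) (b ^ (K ∸ j))) ⟩
      ∑ k (λ j → Q * (B₂ j * κ j) + R * (B₃ j * κ j))
        ≡⟨ ∑-linear k Q R (λ j → B₂ j * κ j) (λ j → B₃ j * κ j) ⟩
      Q * 𝔼 k n 2 κ + R * 𝔼 k n 3 κ
        ≡⟨ cong₂ (λ x y → Q * x + R * y)
                 (𝔼-skew {K = K} n 2 1 {a} {b} b a a+b≡1 (cong (2 ℕ.+_) (ℕ.+-comm n 1)) 2+n<k)
                 (𝔼-skew {K = K} n 3 0 {a} {b} b a a+b≡1 (ℕ.+-identityʳ K) 3+n<k) ⟩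
      Q * ((- (b * (b ^ 2 * a ^ 1)) + a * (a ^ 2 * b ^ 1)) * h)
        + R * ((- (b * (b ^ 3 * a ^ 0)) + a * (a ^ 3 * b ^ 0)) * h) ∎
      where
      open ≡-Reasoning
      K : ℕ
      K = 3 ℕ.+ n
      B₂ B₃ κ : ℕ → ℚ
      B₂ = shiftedBinomial n 2
      B₃ = shiftedBinomial n 3
      κ j = - (b * monomial K b a j) + a * monomial K a b j
      split-weights : ∀ Q R B C β α X Y X′ Y′ →
        (Q * B + R * C) * (- ((β * X) * Y) + (α * X′) * Y′)
          ≡ Q * (B * (- (β * (X * Y)) + α * (X′ * Y′))) + R * (C * (- (β * (X * Y)) + α * (X′ * Y′)))
      split-weights = solve-∀ ℚ-ring

    -- solve-∀ cannot see through _^ℚ_, so this goes through the syntactic solver, whose _:^_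
    -- unfolds to the same products.
    balance-polynomial :
      a * P + b * (Q + R)
      + P * ((- (1ℚ * (b ^ 3 * a ^ 1)) + 1ℚ * (a ^ 3 * b ^ 1)) * h)
      + (Q * ((- (b * (b ^ 2 * a ^ 1)) + a * (a ^ 2 * b ^ 1)) * h)
         + R * ((- (b * (b ^ 3 * a ^ 0)) + a * (a ^ 3 * b ^ 0)) * h))
      ≡ ½
    balance-polynomial = solve 2 (λ δ h →
      let a = con ½ :- δ; b = con ½ :+ δ; P = con ½ :- con ⅓ :* h; Q = con ⅙ :+ con ⅓ :* h; R = con ⅓ in
      a :* P :+ b :* (Q :+ R)
      :+ P :* ((:- (con 1ℚ :* (b :^ 3 :* a :^ 1)) :+ con 1ℚ :* (a :^ 3 :* b :^ 1)) :* h)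
      :+ (Q :* ((:- (b :* (b :^ 2 :* a :^ 1)) :+ a :* (a :^ 2 :* b :^ 1)) :* h)
          :+ R :* ((:- (b :* (b :^ 3 :* a :^ 0)) :+ a :* (a :^ 3 :* b :^ 0)) :* h))
      := con ½) refl δ h

    balance : a * ∑ k u + b * ∑ k v
              + ∑ k (λ j → u j * (- monomial k b a j + monomial k a b j))
              + ∑ k (λ j → v j * (- (b ^ suc j * a ^ (k ∸ 1 ∸ j)) + a ^ suc j * b ^ (k ∸ 1 ∸ j)))
              ≡ ½
    balance =
      trans (cong₂ _+_ (cong₂ _+_ (cong₂ (λ x y → a * x + b * y) ∑u≡P ∑v≡Q+R) ∑u-skew) ∑v-skew)
            balance-polynomial

lemma4p1 : (k : ℕ) → 5 ≤ℕ k →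
    Σ (Fin k → ℚ) λ u → Σ (Fin k → ℚ) λ v →
      ((i : Fin k) → 0ℚ ≤ u i) × ((i : Fin k) → 0ℚ ≤ v i)
      × (sumFin (λ i → u i + v i) ≡ 1ℚ)
      × ((δ : ℚ) → - ½ ≤ δ → δ ≤ ½ →
          (½ - δ) * sumFin u + (½ + δ) * sumFin v
          + sumFin (λ i → u i * ((- (((½ + δ) ^ℚ toℕ i) * ((½ - δ) ^ℚ (k ∸ toℕ i))))
                                 + ((½ - δ) ^ℚ toℕ i) * ((½ + δ) ^ℚ (k ∸ toℕ i))))
          + sumFin (λ i → v i * ((- (((½ + δ) ^ℚ (suc (toℕ i))) * ((½ - δ) ^ℚ (k ∸ 1 ∸ toℕ i))))
                                 + ((½ - δ) ^ℚ (suc (toℕ i))) * ((½ + δ) ^ℚ (k ∸ 1 ∸ toℕ i))))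
          ≡ ½)
      × (1ℚ - (ℕtoℚ (k ∸ 2) * invℕ (k ∸ 1)) * sumFin u
          ≤ invℕ (k ∸ 1) * sumFin (λ i → ℕtoℚ (toℕ i) * (u i + v i)))
lemma4p1 .(5 ℕ.+ m) (s≤s (s≤s (s≤s (s≤s (s≤s {n = m} _))))) =
    (λ i → u (toℕ i)) , (λ i → v (toℕ i))
  , (λ i → u-nonNeg (toℕ i)) , (λ i → v-nonNeg (toℕ i))
  , ∑[u+v]≡1
  -- (ii) is an identity in δ.
  , (λ δ _ _ → balance δ)
  , moment-inequality ([3+n]½^n≤5/2 m)
  where open Witness (suc m)
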